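{- Let $\mathcal{A}$ be a bounded distributive lattice. If $\to$ is a weakly Boolean implication over $\mathcal{A}$, then the interval $[\neg 1, 1] = \{x \in \mathcal{A} \mid \neg 1 \leq x \leq 1\}$ with the induced order is a Boolean algebra, $a \to b = \neg a \vee b$ for all $a,b \in \mathcal{A}$, and $\neg a$ is the complement of $a \vee \neg 1$ in $[\neg 1, 1]$ for every $a \in \mathcal{A}$. Conversely, if for some $m \in \mathcal{A}$ the interval $[m, 1]$ with the induced order is a Boolean algebra, and $n(a)$ denotes the complement of $a \vee m$ in $[m,1]$, then $a \to_m b = n(a) \vee b$ is a weakly Boolean implication over $\mathcal{A}$, with $\neg_m a = n(a)$ and $\neg_m 1 = n(1) = m$ (where $\neg_m a = a \to_m 0$).
   Context: For a bounded distributive lattice $\mathcal{A}$, an implication over $\mathcal{A}$ is a binary operation $\to$ on $\mathcal{A}$ which is order-reversing in its first argument and order-preserving in its second argument and satisfies $a \to a = 1$ and $(a \to b) \wedge (b \to c) \leq a \to c$ for all $a,b,c$. For an implication, $\neg a$ abbreviates $a \to 0$. An implication is open if for all $a,b,c$, $a \wedge b \leq c$ implies $a \leq b \to c$; closed if for all $a,b,c$, $a \leq b \vee c$ implies $(a \to b) \vee c = 1$; weakly Boolean if it is both open and closed. -}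

module Defs where

open import Level using (Level; suc; _⊔_)
open import Data.Product using (Σ; _×_; ∃)
open import Algebra.Definitions using (_DistributesOverˡ_)
open import Relation.Binary.Lattice.Bundles using (BoundedLattice)

record BoundedDistributiveLattice c ℓ₁ ℓ₂ : Set (suc (c ⊔ ℓ₁ ⊔ ℓ₂)) where
  field
    boundedLattice : BoundedLattice c ℓ₁ ℓ₂
  open BoundedLattice boundedLattice public
  field
    ∧-distribˡ-∨ : _DistributesOverˡ_ _≈_ _∧_ _∨_

module Implications {c ℓ₁ ℓ₂} (L : BoundedDistributiveLattice c ℓ₁ ℓ₂) where
  open BoundedDistributiveLattice L

  record IsImplication (_⇒_ : Carrier → Carrier → Carrier) : Set (c ⊔ ℓ₁ ⊔ ℓ₂) where
    field
      antitoneˡ : ∀ {a a′ b} → a ≤ a′ → (a′ ⇒ b) ≤ (a ⇒ b)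
      monotoneʳ : ∀ {a b b′} → b ≤ b′ → (a ⇒ b) ≤ (a ⇒ b′)
      refl⇒     : ∀ a → (a ⇒ a) ≈ ⊤
      trans⇒    : ∀ a b d → ((a ⇒ b) ∧ (b ⇒ d)) ≤ (a ⇒ d)

  neg : (Carrier → Carrier → Carrier) → Carrier → Carrier
  neg _⇒_ a = a ⇒ ⊥

  IsOpen : (Carrier → Carrier → Carrier) → Set (c ⊔ ℓ₂)
  IsOpen _⇒_ = ∀ a b d → (a ∧ b) ≤ d → a ≤ (b ⇒ d)

  IsClosed : (Carrier → Carrier → Carrier) → Set (c ⊔ ℓ₁ ⊔ ℓ₂)
  IsClosed _⇒_ = ∀ a b d → a ≤ (b ∨ d) → ((a ⇒ b) ∨ d) ≈ ⊤

  record IsWeaklyBoolean (_⇒_ : Carrier → Carrier → Carrier) : Set (c ⊔ ℓ₁ ⊔ ℓ₂) where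
    field
      isImplication : IsImplication _⇒_
      isOpen        : IsOpen _⇒_
      isClosed      : IsClosed _⇒_

  -- y is a complement of x in the interval [m, 1] (both meet and join of
  -- the interval are those of L, and its bounds are m and ⊤)
  IsComplementIn : Carrier → Carrier → Carrier → Set ℓ₁
  IsComplementIn m x y = ((x ∧ y) ≈ m) × ((x ∨ y) ≈ ⊤)

  -- membership in the interval [m, 1] (upper bound ⊤ is automatic)
  InInterval : Carrier → Carrier → Set ℓ₂
  InInterval m x = m ≤ x

  -- It is a sublattice of L (closed under ∧, ∨), hence a bounded
  -- distributive lattice with bottom m and top ⊤; so being a Boolean
  -- algebra amounts to every element having a complement in it.
  IntervalIsBoolean : Carrier → Set (c ⊔ ℓ₁ ⊔ ℓ₂)
  IntervalIsBoolean m =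
    ∀ x → InInterval m x → Σ Carrier (λ y → InInterval m y × IsComplementIn m x y)

-- Openness of a weakly Boolean implication gives b ≤ a → b and a ≤ 1 → a,
-- closedness gives excluded middle ¬ a ∨ a = 1, and transitivity bounds
-- a ∧ ¬ a ≤ (1 → a) ∧ (a → 0) by ¬ 1; hence ¬ a is the complement of a ∨ ¬ 1 in
-- [¬ 1, 1], and splitting a → b along ¬ b ∨ b = 1 yields a → b = ¬ a ∨ b.
-- Conversely, every axiom for a ↦ n a ∨ b follows from two distributive-lattice
-- facts: x ≤ (x ∧ y) ∨ z whenever y ∨ z = 1, and the resolution rule
-- (x ∨ y) ∧ (z ∨ w) ≤ x ∨ w whenever y ∧ z ≤ x.
{-# OPTIONS --safe #-}
module Submission where

open import Defs
open import Data.Product using (_×_; _,_; proj₁; proj₂)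
open import Level using (_⊔_)

module _ {c ℓ₁ ℓ₂} (L : BoundedDistributiveLattice c ℓ₁ ℓ₂) where
  open BoundedDistributiveLattice L
  open Implications L
  open import Relation.Binary.Lattice.Properties.JoinSemilattice joinSemilattice
    using (∨-monotonic; ∨-cong; ∨-comm; x≤y⇒x∨y≈y)
  open import Relation.Binary.Lattice.Properties.MeetSemilattice meetSemilattice
    using (∧-monotonic; ∧-cong; ∧-comm)
  open import Relation.Binary.Lattice.Properties.BoundedJoinSemilattice boundedJoinSemilattice
    using (identityʳ)
  open import Relation.Binary.Reasoning.PartialOrder poset

  ≈⊤-upward : ∀ {x y} → x ≈ ⊤ → x ≤ y → y ≈ ⊤
  ≈⊤-upward x≈⊤ x≤y = antisym (maximum _) (trans (reflexive (Eq.sym x≈⊤)) x≤y)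

  y∨z≈⊤⇒x≤x∧y∨z : ∀ {x y z} → y ∨ z ≈ ⊤ → x ≤ x ∧ y ∨ z
  y∨z≈⊤⇒x≤x∧y∨z {x} {y} {z} y∨z≈⊤ = begin
    x              ≤⟨ ∧-greatest refl (trans (maximum x) (reflexive (Eq.sym y∨z≈⊤))) ⟩
    x ∧ (y ∨ z)    ≈⟨ ∧-distribˡ-∨ x y z ⟩
    x ∧ y ∨ x ∧ z  ≤⟨ ∨-monotonic refl (x∧y≤y x z) ⟩
    x ∧ y ∨ z      ∎

  ∧-distribʳ-∨-least : ∀ {x y z w} → x ∧ z ≤ w → y ∧ z ≤ w → (x ∨ y) ∧ z ≤ w
  ∧-distribʳ-∨-least {x} {y} {z} {w} x∧z≤w y∧z≤w = begin
    (x ∨ y) ∧ z    ≈⟨ ∧-comm _ _ ⟩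
    z ∧ (x ∨ y)    ≈⟨ ∧-distribˡ-∨ z x y ⟩
    z ∧ x ∨ z ∧ y  ≤⟨ ∨-least (trans (reflexive (∧-comm z x)) x∧z≤w)
                              (trans (reflexive (∧-comm z y)) y∧z≤w) ⟩
    w              ∎

  resolution : ∀ {x y z w} → y ∧ z ≤ x → (x ∨ y) ∧ (z ∨ w) ≤ x ∨ w
  resolution {x} {y} {z} {w} y∧z≤x = begin
    (x ∨ y) ∧ (z ∨ w)              ≈⟨ ∧-distribˡ-∨ (x ∨ y) z w ⟩
    (x ∨ y) ∧ z ∨ (x ∨ y) ∧ w      ≤⟨ ∨-monotonic (∧-distribʳ-∨-least (x∧y≤x x z) y∧z≤x)
                                                   (x∧y≤y (x ∨ y) w) ⟩
    x ∨ w                          ∎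

  IsComplementIn-respˡ : ∀ {m x x′ y} → x ≈ x′ → IsComplementIn m x y → IsComplementIn m x′ y
  IsComplementIn-respˡ x≈x′ (x∧y≈m , x∨y≈⊤) =
      Eq.trans (∧-cong (Eq.sym x≈x′) Eq.refl) x∧y≈m
    , Eq.trans (∨-cong (Eq.sym x≈x′) Eq.refl) x∨y≈⊤

  ∨-complementIn : ∀ {m x y} → m ≤ y → x ∧ y ≤ m → x ∨ y ≈ ⊤ → IsComplementIn m (x ∨ m) y
  ∨-complementIn {m} {x} {y} m≤y x∧y≤m x∨y≈⊤ =
      antisym (∧-distribʳ-∨-least x∧y≤m (x∧y≤x m y)) (∧-greatest (y≤x∨y x m) m≤y)
    , ≈⊤-upward x∨y≈⊤ (∨-monotonic (x≤x∨y x m) refl)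

  IsComplementMap : Carrier → (Carrier → Carrier) → Set (c ⊔ ℓ₁ ⊔ ℓ₂)
  IsComplementMap m n = ∀ a → InInterval m (n a) × IsComplementIn m (a ∨ m) (n a)

  complementMap⇒intervalIsBoolean : ∀ {m n} → IsComplementMap m n → IntervalIsBoolean m
  complementMap⇒intervalIsBoolean {m} {n} isComplement x m≤x =
    n x , proj₁ (isComplement x) , IsComplementIn-respˡ x∨m≈x (proj₂ (isComplement x))
    where
    x∨m≈x : x ∨ m ≈ x
    x∨m≈x = Eq.trans (∨-comm x m) (x≤y⇒x∨y≈y m≤x)

  module WeaklyBoolean {_⇒_ : Carrier → Carrier → Carrier} (isWeaklyBoolean : IsWeaklyBoolean _⇒_) where
    open IsWeaklyBoolean isWeaklyBoolean
    open IsImplication isImplication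

    ¬_ : Carrier → Carrier
    ¬_ = neg _⇒_

    y≤x⇒y : ∀ x y → y ≤ x ⇒ y
    y≤x⇒y x y = isOpen y x y (x∧y≤x y x)

    ¬x∨x≈⊤ : ∀ x → ¬ x ∨ x ≈ ⊤
    ¬x∨x≈⊤ x = isClosed x ⊥ x (y≤x∨y ⊥ x)

    ⇒≈¬∨ : ∀ x y → x ⇒ y ≈ ¬ x ∨ y
    ⇒≈¬∨ x y = antisym x⇒y≤¬x∨y (∨-least (monotoneʳ (minimum y)) (y≤x⇒y x y))
      where
      x⇒y≤¬x∨y : x ⇒ y ≤ ¬ x ∨ y
      x⇒y≤¬x∨y = begin
        x ⇒ y                ≤⟨ y∨z≈⊤⇒x≤x∧y∨z (¬x∨x≈⊤ y) ⟩
        (x ⇒ y) ∧ ¬ y ∨ y    ≤⟨ ∨-monotonic (trans⇒ x y ⊥) refl ⟩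
        ¬ x ∨ y              ∎

    ¬⊤≤¬x : ∀ x → ¬ ⊤ ≤ ¬ x
    ¬⊤≤¬x x = antitoneˡ (maximum x)

    x∧¬x≤¬⊤ : ∀ x → x ∧ ¬ x ≤ ¬ ⊤
    x∧¬x≤¬⊤ x = trans (∧-monotonic (y≤x⇒y ⊤ x) refl) (trans⇒ ⊤ x ⊥)

    ¬-isComplementMap : IsComplementMap (¬ ⊤) ¬_
    ¬-isComplementMap x =
      ¬⊤≤¬x x , ∨-complementIn (¬⊤≤¬x x) (x∧¬x≤¬⊤ x) (Eq.trans (∨-comm x (¬ x)) (¬x∨x≈⊤ x))

  module Complementation {m : Carrier} {n : Carrier → Carrier} (isComplement : IsComplementMap m n) where

    m≤n : ∀ x → m ≤ n x
    m≤n x = proj₁ (isComplement x)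

    [x∨m]∧n[x]≤m : ∀ x → (x ∨ m) ∧ n x ≤ m
    [x∨m]∧n[x]≤m x = reflexive (proj₁ (proj₂ (isComplement x)))

    [x∨m]∨n[x]≈⊤ : ∀ x → (x ∨ m) ∨ n x ≈ ⊤
    [x∨m]∨n[x]≈⊤ x = proj₂ (proj₂ (isComplement x))

    x∧n[x]≤m : ∀ x → x ∧ n x ≤ m
    x∧n[x]≤m x = trans (∧-monotonic (x≤x∨y x m) refl) ([x∨m]∧n[x]≤m x)

    n-antitone : ∀ {x y} → x ≤ y → n y ≤ n x
    n-antitone {x} {y} x≤y = begin
      n y                    ≤⟨ y∨z≈⊤⇒x≤x∧y∨z ([x∨m]∨n[x]≈⊤ x) ⟩
      n y ∧ (x ∨ m) ∨ n x    ≤⟨ ∨-least n[y]∧[x∨m]≤n[x] refl ⟩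
      n x                    ∎
      where
      n[y]∧[x∨m]≤n[x] : n y ∧ (x ∨ m) ≤ n x
      n[y]∧[x∨m]≤n[x] = begin
        n y ∧ (x ∨ m)  ≈⟨ ∧-comm (n y) (x ∨ m) ⟩
        (x ∨ m) ∧ n y  ≤⟨ ∧-monotonic (∨-monotonic x≤y refl) refl ⟩
        (y ∨ m) ∧ n y  ≤⟨ [x∨m]∧n[x]≤m y ⟩
        m              ≤⟨ m≤n x ⟩
        n x            ∎

    n⊤≈m : n ⊤ ≈ m
    n⊤≈m = antisym (trans (∧-greatest (maximum (n ⊤)) refl) (x∧n[x]≤m ⊤)) (m≤n ⊤)

    _⇒ₙ_ : Carrier → Carrier → Carrier
    x ⇒ₙ y = n x ∨ y

    ⇒ₙ-isImplication : IsImplication _⇒ₙ_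
    ⇒ₙ-isImplication = record
      { antitoneˡ = λ x≤x′ → ∨-monotonic (n-antitone x≤x′) refl
      ; monotoneʳ = ∨-monotonic refl
      ; refl⇒     = λ x → ≈⊤-upward ([x∨m]∨n[x]≈⊤ x)
          (∨-least (∨-least (y≤x∨y (n x) x) (trans (m≤n x) (x≤x∨y (n x) x))) (x≤x∨y (n x) x))
      ; trans⇒    = λ x y z → resolution (trans (x∧n[x]≤m y) (m≤n x))
      }

    ⇒ₙ-isOpen : IsOpen _⇒ₙ_
    ⇒ₙ-isOpen x y z x∧y≤z = begin
      x                          ≤⟨ y∨z≈⊤⇒x≤x∧y∨z ([x∨m]∨n[x]≈⊤ y) ⟩
      x ∧ (y ∨ m) ∨ n y          ≈⟨ ∨-cong (∧-distribˡ-∨ x y m) Eq.refl ⟩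
      (x ∧ y ∨ x ∧ m) ∨ n y      ≤⟨ ∨-least (∨-least (trans x∧y≤z (y≤x∨y (n y) z)) x∧m≤n[y]∨z)
                                             (x≤x∨y (n y) z) ⟩
      n y ∨ z                    ∎
      where
      x∧m≤n[y]∨z : x ∧ m ≤ n y ∨ z
      x∧m≤n[y]∨z = trans (x∧y≤y x m) (trans (m≤n y) (x≤x∨y (n y) z))

    ⇒ₙ-isClosed : IsClosed _⇒ₙ_
    ⇒ₙ-isClosed x y z x≤y∨z = ≈⊤-upward ([x∨m]∨n[x]≈⊤ x)
      (∨-least (∨-least x≤[n[x]∨y]∨z (trans (m≤n x) n[x]≤[n[x]∨y]∨z)) n[x]≤[n[x]∨y]∨z)
      where
      n[x]≤[n[x]∨y]∨z : n x ≤ (n x ∨ y) ∨ z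
      n[x]≤[n[x]∨y]∨z = trans (x≤x∨y (n x) y) (x≤x∨y (n x ∨ y) z)
      x≤[n[x]∨y]∨z : x ≤ (n x ∨ y) ∨ z
      x≤[n[x]∨y]∨z = trans x≤y∨z (∨-monotonic (y≤x∨y (n x) y) refl)

    ⇒ₙ-isWeaklyBoolean : IsWeaklyBoolean _⇒ₙ_
    ⇒ₙ-isWeaklyBoolean = record
      { isImplication = ⇒ₙ-isImplication
      ; isOpen        = ⇒ₙ-isOpen
      ; isClosed      = ⇒ₙ-isClosed
      }

    neg-⇒ₙ≈n : ∀ x → neg _⇒ₙ_ x ≈ n x
    neg-⇒ₙ≈n x = identityʳ (n x)

theorem3p12 : ∀ {c ℓ₁ ℓ₂} (L : BoundedDistributiveLattice c ℓ₁ ℓ₂) →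
    let open BoundedDistributiveLattice L
        open Implications L
    in
    -- (1) weakly Boolean implications
    (∀ (_⇒_ : Carrier → Carrier → Carrier) → IsWeaklyBoolean _⇒_ →
        IntervalIsBoolean (neg _⇒_ ⊤)
      × (∀ a b → (a ⇒ b) ≈ (neg _⇒_ a ∨ b))
      × (∀ a → InInterval (neg _⇒_ ⊤) (neg _⇒_ a)
             × IsComplementIn (neg _⇒_ ⊤) (a ∨ neg _⇒_ ⊤) (neg _⇒_ a)))
    ×
    -- (2) converse
    (∀ (m : Carrier) → IntervalIsBoolean m →
      ∀ (n : Carrier → Carrier) →
      (∀ a → InInterval m (n a) × IsComplementIn m (a ∨ m) (n a)) →
        IsWeaklyBoolean (λ a b → n a ∨ b)
      × (∀ a → neg (λ x y → n x ∨ y) a ≈ n a)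
      × (neg (λ x y → n x ∨ y) ⊤ ≈ n ⊤)
      × (n ⊤ ≈ m))
theorem3p12 L =
    (λ _⇒_ isWeaklyBoolean →
      let open WeaklyBoolean L isWeaklyBoolean
      in complementMap⇒intervalIsBoolean L ¬-isComplementMap , ⇒≈¬∨ , ¬-isComplementMap)
  , (λ m _ n isComplement →
      -- The complements are supplied by n.
      let open Complementation L isComplement
      in ⇒ₙ-isWeaklyBoolean , neg-⇒ₙ≈n , neg-⇒ₙ≈n _ , n⊤≈m)
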